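{- Let $p$ be a prime and $K/\mathbb{Q}_p$ a finite extension with absolute ramification index $e$ and residue field of cardinality $q=p^h$, and let $\varpi_p$ be as in the context. Suppose $e\le p-1$, and that $e>1$ or $h>1$. Then: (i) $|n!/\varpi_p^n|>1$ for all $0<n<q$. (ii) For every non-negative integer $n$, $|\underline{\gamma}(n)|=|n_0!/\varpi_p^{n_0}|$ where $n_0=[n/q]q$. (iii) For every $n\equiv-1\bmod q$ and every integer $1\le i\le q-1$, $$\left|\frac{n!}{\varpi_p^n}\right|>\left|\frac{(n+q)!}{\varpi_p^{n+q}}\right|>\left|\frac{(n+i)!}{\varpi_p^{n+i}}\right|.$$ In particular, for every non-negative integer $n$, $|\overline{\gamma}(n)|=|n_1!/\varpi_p^{n_1}|$ where $n_1=[n/q]q+q-1$.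
   Context: $|\cdot|$ on $\mathbb{C}_p$ with $|p|=p^{ -1}$; $[\cdot]$ is the integer part. $\mathcal{G}$ is a Lubin–Tate formal group over $\mathcal{O}_K$ with logarithm $\lambda(t)$, and $\varpi_p\in\mathcal{O}_{\mathbb{C}_p}$ is a fixed $p$-adic period: $\exp(\varpi_p\lambda(t))\in\mathcal{O}_{\mathbb{C}_p}[[t]]$ generates the $\mathcal{O}_K$-module $\mathrm{Hom}_{\mathcal{O}_{\mathbb{C}_p}}(\mathcal{G},\widehat{\mathbb{G}}_m)$; it satisfies $|\varpi_p|=p^{ -1/(p-1)+1/(e(q-1))}$. $\overline{\gamma}(k)$, $\underline{\gamma}(k)$ are any elements with $|\overline{\gamma}(k)|=\max_{m\ge k}|m!/\varpi_p^m|$ and $|\underline{\gamma}(k)|=\min_{0\le m\le k}|m!/\varpi_p^m|$. -}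

module Defs where

open import Data.Nat as ℕ using (ℕ; zero; suc; _∸_; _^_; _!; NonZero)
open import Data.Nat.Properties using (m^n≢0)
open import Data.Nat.Divisibility using (_∣?_)
open import Data.Nat.Primality using (Prime)
open import Data.Integer using (+_)
open import Data.Rational using (ℚ; 0ℚ; _/_; _-_; _*_)
open import Relation.Nullary using (yes; no)

-- p-adic valuation of m (number of times p divides m), computed with fuel;
-- fuel = m suffices since p ≥ 2.  Conventions: valuation of 0 is 0, and the
-- function returns 0 for p ∈ {0,1} (never used: p is prime in the statement).
valF : ℕ → ℕ → ℕ → ℕ
valF zero _ _ = 0
valF (suc f) zero m = 0
valF (suc f) (suc zero) m = 0
valF (suc f) (suc (suc k)) zero = 0
valF (suc f) (suc (suc k)) (suc m) with suc (suc k) ∣? suc m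
... | yes _ = suc (valF f (suc (suc k)) (ℕ._/_ (suc m) (suc (suc k))))
... | no _ = 0

val : ℕ → ℕ → ℕ
val p m = valF m p m

-- 1/d as a rational (d ≠ 0 in all uses)
inv : ℕ → ℚ
inv zero = 0ℚ
inv (suc d) = + 1 / suc d

-- v_p(ϖ_p) = 1/(p-1) - 1/(e(q-1)), with q = p^h
valPeriod : (p e h : ℕ) → ℚ
valPeriod p e h = inv (p ∸ 1) - inv (e ℕ.* (p ^ h ∸ 1))

-- ord p e h n = v_p(n!/ϖ_p^n) = v_p(n!) - n·v_p(ϖ_p),
-- so that |n!/ϖ_p^n| = p^(-ord p e h n).
-- Hence |a| > |b|  iff  ord a < ord b,  and |a| > 1 iff ord a < 0.
ord : (p e h n : ℕ) → ℚ
ord p e h n = (+ val p (n !) / 1) - (+ n / 1) * valPeriod p e h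

-- [n/q]·q with q = p^h (p is prime hence nonzero; 0 returned for p = 0)
floorMul : (p h n : ℕ) → ℕ
floorMul zero h n = 0
floorMul (suc p) h n =
  ℕ._*_ (ℕ._/_ n (suc p ^ h) {{m^n≢0 (suc p) h}}) (suc p ^ h)

module Submission where

-- Write B = p - 1, A = e(q - 1), q = p^h and V(n) = v_p(n!) (module Valuation
-- develops v_p and V: multiplicativity, Legendre's formula, blocks of length q).  Since
-- v_p(ϖ_p) = 1/B - 1/A, the integer  G(n) = A·B·ord(n) = A·B·V(n) + B·n - A·n
-- orders the values ord(n) exactly as the rationals do (module Scaling), so
-- everything reduces to arithmetic of V.  Legendre's formula B·V(j) = j - s(j)
-- (s the base-p digit sum) turns G into  G(j) = B·j - A·s(j), and gives
--   * G(j) < 0 for 0 < j < q, because j ≤ s(j)·p^(h-1) and p^(h-1)·B < A;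
--   * G(q) > 0, because s(q) = 1 and A < B·q;
--   * G(c·q + j) = G(c·q) + G(j) for j < q, and G((c+1)q) = G(cq) + G(q) + A·B·v_p(c+1),
--     so G is increasing along multiples of q;
--   * G(q-1) = G(j) + G(q-1-j) for j ≤ q-1, so q-1 minimises G on [0, q).
-- These facts, and from them the four assertions, are proved for any A with
-- p^(h-1)·B < A < B·q (module Weights); the hypotheses e ≤ p - 1 and (e > 1 or
-- h > 1) ensure that A = e(q-1) is such (denominator-bounds), which gives the theorem.

open import Defs
open import Data.Nat using (ℕ; _+_; _∸_; _^_; _≤_; _<_; _%_)
open import Data.Nat.Primality using (Prime)
open import Data.Nat.Divisibility using (_∣_)
open import Data.Rational using (0ℚ) renaming (_<_ to _<ℚ_; _≤_ to _≤ℚ_)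
open import Data.Product using (_×_)
open import Data.Sum using (_⊎_)

open import Data.Nat using (zero; suc; NonZero; _*_; _!; z≤n; s≤s; _≤′_; ≤′-refl; ≤′-step; nonTrivial⇒n>1)
open import Data.Nat.Properties
open import Data.Nat.Divisibility using (divides; ∣m∣n⇒∣m+n; _∣?_; ∣-trans; m∣m*n; n∣m*n; ∣m+n∣m⇒∣n; ∣1⇒≡1; ∣⇒≤; *-cancelˡ-∣)
open import Data.Nat.DivMod using (_/_; m/n<m; m*n/n≡m; m≡m%n+[m/n]*n; m%n<n; m/n*n≤m; /-monoˡ-≤)
open import Data.Nat.Primality using (euclidsLemma; prime⇒nonTrivial)
open import Data.Nat.Tactic.RingSolver using (solve-∀)
open import Data.Integer as Z using (ℤ; _⊖_)
import Data.Integer.Properties as ZP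
import Data.Integer.Tactic.RingSolver as ZR
open import Data.Rational as Q using (ℚ; toℚᵘ)
import Data.Rational.Properties as QP
open import Data.Rational.Unnormalised as U using (ℚᵘ; mkℚᵘ; *≡*; *<*; *≤*)
import Data.Rational.Unnormalised.Properties as UP
import Tactic.RingSolver as RS
open import Tactic.RingSolver.Core.AlmostCommutativeRing using (fromCommutativeRing; AlmostCommutativeRing)
open import Data.Maybe using (nothing)
open import Level using (0ℓ)
open import Data.Product using (Σ; _,_; proj₁; proj₂)
open import Data.Sum using (inj₁; inj₂; map₂)
open import Relation.Nullary using (¬_; yes; no; contradiction)
open import Relation.Binary.PropositionalEquality


*-positive : ∀ {x y} → 0 < x → 0 < y → 0 < x * y
*-positive {suc _} {suc _} _ _ = s≤s z≤n

⊖-positive : ∀ {s t} → t < s → Z.+ 0 Z.< s ⊖ t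
⊖-positive t<s = subst (Z.+ 0 Z.<_) (sym (ZP.⊖-≥ (<⇒≤ t<s))) (Z.+<+ (m<n⇒0<n∸m t<s))

⊖-negative : ∀ {s t} → s < t → s ⊖ t Z.< Z.+ 0
⊖-negative {s} {t} s<t = subst (Z._< Z.+ 0) (sym (ZP.⊖-swap s t)) (ZP.neg-mono-< (⊖-positive s<t))

plus-nonpositive : ∀ x {y} → y Z.≤ Z.+ 0 → x Z.+ y Z.≤ x
plus-nonpositive x y≤0 = subst (x Z.+ _ Z.≤_) (ZP.+-identityʳ x) (ZP.+-monoʳ-≤ x y≤0)

plus-negative : ∀ x {y} → y Z.< Z.+ 0 → x Z.+ y Z.< x
plus-negative x y<0 = subst (x Z.+ _ Z.<_) (ZP.+-identityʳ x) (ZP.+-monoʳ-< x y<0)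


module Valuation (k : ℕ) (p-prime : Prime (suc (suc k))) where

  open ≤-Reasoning

  p : ℕ
  p = suc (suc k)

  1<p : 1 < p
  1<p = s≤s (s≤s z≤n)

  v : ℕ → ℕ
  v m = val p m

  valF-divisible : ∀ f m → p ∣ suc m → valF (suc f) p (suc m) ≡ suc (valF f p (suc m / p))
  valF-divisible f m p∣m with p ∣? suc m
  ... | yes _ = refl
  ... | no p∤m = contradiction p∣m p∤m

  valF-indivisible : ∀ f m → ¬ p ∣ suc m → valF (suc f) p (suc m) ≡ 0
  valF-indivisible f m p∤m with p ∣? suc m
  ... | yes p∣m = contradiction p∣m p∤m
  ... | no _ = refl

  valF-fuel : ∀ f g m → m ≤ f → m ≤ g → valF f p m ≡ valF g p m
  valF-fuel zero zero zero _ _ = refl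
  valF-fuel zero (suc g) zero _ _ = refl
  valF-fuel (suc f) zero zero _ _ = refl
  valF-fuel (suc f) (suc g) zero _ _ = refl
  valF-fuel (suc f) (suc g) (suc m) (s≤s m≤f) (s≤s m≤g) with p ∣? suc m
  ... | yes _ = cong suc (valF-fuel f g (suc m / p) (≤-trans quotient≤m m≤f) (≤-trans quotient≤m m≤g))
    where
    quotient≤m : suc m / p ≤ m
    quotient≤m = ≤-pred (m/n<m (suc m) p 1<p)
  ... | no _ = refl

  v-indivisible : ∀ x → 0 < x → ¬ p ∣ x → v x ≡ 0
  v-indivisible (suc x) _ = valF-indivisible x x

  v-p* : ∀ x → 0 < x → v (p * x) ≡ suc (v x)
  v-p* (suc x) _ = begin-equality
    valF (suc f) p (suc f)                 ≡⟨ valF-divisible f f (m∣m*n (suc x)) ⟩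
    suc (valF f p (p * suc x / p))         ≡⟨ cong (λ y → suc (valF f p y)) p*x/p≡x ⟩
    suc (valF f p (suc x))                 ≡⟨ cong suc (valF-fuel f (suc x) (suc x) x≤f ≤-refl) ⟩
    suc (v (suc x))                        ∎
    where
    f : ℕ
    f = x + suc k * suc x
    x≤f : suc x ≤ f
    x≤f = ≤-trans (m≤m+n (suc x) (k * suc x)) (m≤n+m _ x)
    p*x/p≡x : p * suc x / p ≡ suc x
    p*x/p≡x = trans (cong (_/ p) (*-comm p (suc x))) (m*n/n≡m (suc x) p)

  v-p^* : ∀ h x → 0 < x → v (p ^ h * x) ≡ h + v x
  v-p^* zero x _ = cong v (+-identityʳ x)
  v-p^* (suc h) x x>0 = begin-equality
    v (p * p ^ h * x)     ≡⟨ cong v (*-assoc p (p ^ h) x) ⟩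
    v (p * (p ^ h * x))   ≡⟨ v-p* (p ^ h * x) (*-positive (m^n>0 p h) x>0) ⟩
    suc (v (p ^ h * x))   ≡⟨ cong suc (v-p^* h x x>0) ⟩
    suc h + v x           ∎

  divide-by-p : ∀ {x} → 0 < x → p ∣ x → Σ ℕ λ y → (x ≡ p * y) × (0 < y) × (y < x)
  divide-by-p x>0 (divides zero x≡0) = contradiction x≡0 (≢-sym (<⇒≢ x>0))
  divide-by-p {x} _ (divides (suc y) x≡y*p) =
    suc y , trans x≡y*p (*-comm (suc y) p) , s≤s z≤n ,
    subst (suc y <_) (sym x≡y*p) (m<m*n (suc y) p 1<p)

  v-* : ∀ x y → 0 < x → 0 < y → v (x * y) ≡ v x + v y
  v-* x y = bounded (x + y) x y ≤-refl
    where
    bounded : ∀ f x y → x + y ≤ f → 0 < x → 0 < y → v (x * y) ≡ v x + v y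
    bounded zero (suc x) y () _ _
    bounded (suc f) x y x+y≤ x>0 y>0 with p ∣? x | p ∣? y
    ... | yes p∣x | _ with divide-by-p x>0 p∣x
    ...   | x₁ , x≡px₁ , x₁>0 , x₁<x = begin-equality
      v (x * y)             ≡⟨ cong v (trans (cong (_* y) x≡px₁) (*-assoc p x₁ y)) ⟩
      v (p * (x₁ * y))      ≡⟨ v-p* (x₁ * y) (*-positive x₁>0 y>0) ⟩
      suc (v (x₁ * y))      ≡⟨ cong suc (bounded f x₁ y (≤-pred (≤-trans (+-monoˡ-< y x₁<x) x+y≤)) x₁>0 y>0) ⟩
      suc (v x₁) + v y      ≡⟨ cong (_+ v y) (sym (trans (cong v x≡px₁) (v-p* x₁ x₁>0))) ⟩
      v x + v y             ∎
    bounded (suc f) x y x+y≤ x>0 y>0 | no p∤x | yes p∣y with divide-by-p y>0 p∣y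
    ...   | y₁ , y≡py₁ , y₁>0 , y₁<y = begin-equality
      v (x * y)             ≡⟨ cong v (trans (cong (x *_) y≡py₁) (x*[p*y]≡p*[x*y] x y₁)) ⟩
      v (p * (x * y₁))      ≡⟨ v-p* (x * y₁) (*-positive x>0 y₁>0) ⟩
      suc (v (x * y₁))      ≡⟨ cong suc (bounded f x y₁ (≤-pred (≤-trans (+-monoʳ-< x y₁<y) x+y≤)) x>0 y₁>0) ⟩
      suc (v x + v y₁)      ≡⟨ sym (+-suc (v x) (v y₁)) ⟩
      v x + suc (v y₁)      ≡⟨ cong (λ t → v x + t) (sym (trans (cong v y≡py₁) (v-p* y₁ y₁>0))) ⟩
      v x + v y             ∎
      where
      x*[p*y]≡p*[x*y] : ∀ a b → a * (p * b) ≡ p * (a * b)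
      x*[p*y]≡p*[x*y] a b = trans (sym (*-assoc a p b)) (trans (cong (_* b) (*-comm a p)) (*-assoc p a b))
    bounded (suc f) x y _ x>0 y>0 | no p∤x | no p∤y = begin-equality
      v (x * y)   ≡⟨ v-indivisible (x * y) (*-positive x>0 y>0) p∤xy ⟩
      0           ≡⟨ sym (cong₂ _+_ (v-indivisible x x>0 p∤x) (v-indivisible y y>0 p∤y)) ⟩
      v x + v y   ∎
      where
      p∤xy : ¬ p ∣ x * y
      p∤xy p∣xy with euclidsLemma x y p-prime p∣xy
      ... | inj₁ p∣x = p∤x p∣x
      ... | inj₂ p∣y = p∤y p∣y

  v-mod-p^ : ∀ h x y → 0 < x → 0 < y → y < p ^ h → p ^ h ∣ x + y → v x ≡ v y
  v-mod-p^ zero x (suc y) _ _ (s≤s ()) _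
  v-mod-p^ (suc h) x y x>0 y>0 y<p^h p^h∣x+y with p ∣? y
  ... | no p∤y = trans (v-indivisible x x>0 p∤x) (sym (v-indivisible y y>0 p∤y))
    where
    p∤x : ¬ p ∣ x
    p∤x p∣x = p∤y (∣m+n∣m⇒∣n (∣-trans (m∣m*n (p ^ h)) p^h∣x+y) p∣x)
  ... | yes p∣y with divide-by-p y>0 p∣y
  ...   | y₁ , y≡py₁ , y₁>0 , _
      with divide-by-p x>0 (∣m+n∣m⇒∣n (subst (p ∣_) (+-comm x y) (∣-trans (m∣m*n (p ^ h)) p^h∣x+y)) p∣y)
  ...     | x₁ , x≡px₁ , x₁>0 , _ = begin-equality
    v x          ≡⟨ trans (cong v x≡px₁) (v-p* x₁ x₁>0) ⟩
    suc (v x₁)   ≡⟨ cong suc (v-mod-p^ h x₁ y₁ x₁>0 y₁>0 y₁<p^h p^h∣x₁+y₁) ⟩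
    suc (v y₁)   ≡⟨ sym (trans (cong v y≡py₁) (v-p* y₁ y₁>0)) ⟩
    v y          ∎
    where
    y₁<p^h : y₁ < p ^ h
    y₁<p^h = *-cancelˡ-< p y₁ (p ^ h) (subst (_< p * p ^ h) y≡py₁ y<p^h)
    p^h∣x₁+y₁ : p ^ h ∣ x₁ + y₁
    p^h∣x₁+y₁ = *-cancelˡ-∣ p (subst (p * p ^ h ∣_)
      (trans (cong₂ _+_ x≡px₁ y≡py₁) (sym (*-distribˡ-+ p x₁ y₁))) p^h∣x+y)

  v-shift : ∀ h x y → p ^ h ∣ x → 0 < y → y < p ^ h → v (x + y) ≡ v y
  v-shift h x y p^h∣x y>0 y<p^h =
    trans (v-mod-p^ h (x + y) m (≤-trans y>0 (m≤n+m y x)) m>0 m<p^h p^h∣x+y+m)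
          (sym (v-mod-p^ h y m y>0 m>0 m<p^h p^h∣y+m))
    where
    m : ℕ
    m = p ^ h ∸ y
    y+m≡p^h : y + m ≡ p ^ h
    y+m≡p^h = m+[n∸m]≡n (<⇒≤ y<p^h)
    m>0 : 0 < m
    m>0 = m<n⇒0<n∸m y<p^h
    m<p^h : m < p ^ h
    m<p^h = subst (m <_) y+m≡p^h (m<n+m m y>0)
    p^h∣y+m : p ^ h ∣ y + m
    p^h∣y+m = subst (p ^ h ∣_) (sym y+m≡p^h) (divides 1 (sym (*-identityˡ (p ^ h))))
    p^h∣x+y+m : p ^ h ∣ x + y + m
    p^h∣x+y+m = subst (p ^ h ∣_) (sym (+-assoc x y m)) (∣m∣n⇒∣m+n p^h∣x p^h∣y+m)

  V : ℕ → ℕ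
  V n = v (n !)

  V-zero : V 0 ≡ 0
  V-zero = v-indivisible 1 (s≤s z≤n) (λ p∣1 → <⇒≢ 1<p (sym (∣1⇒≡1 p∣1)))

  V-suc : ∀ n → V (suc n) ≡ v (suc n) + V n
  V-suc n = v-* (suc n) (n !) (s≤s z≤n) (1≤n! n)

  -- V does not change inside a digit block: p·a + 1, …, p·a + r (r < p) are prime to p.
  V-same-block : ∀ a r → r < p → V (p * a + r) ≡ V (p * a)
  V-same-block a zero _ = cong V (+-identityʳ (p * a))
  V-same-block a (suc r) r<p = begin-equality
    V (p * a + suc r)                    ≡⟨ cong V (+-suc (p * a) r) ⟩
    V (suc (p * a + r))                  ≡⟨ V-suc (p * a + r) ⟩
    v (suc (p * a + r)) + V (p * a + r)  ≡⟨ cong₂ _+_ (v-indivisible _ (s≤s z≤n) p∤)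
                                                     (V-same-block a r (<⇒≤ r<p)) ⟩
    V (p * a)                            ∎
    where
    p∤ : ¬ p ∣ suc (p * a + r)
    p∤ p∣ = <⇒≱ r<p (∣⇒≤ (∣m+n∣m⇒∣n (subst (p ∣_) (sym (+-suc (p * a) r)) p∣) (m∣m*n a)))

  V-p* : ∀ a → V (p * a) ≡ a + V a
  V-p* zero = trans (cong V (*-zeroʳ p)) V-zero
  V-p* (suc a) = begin-equality
    V (p * suc a)                           ≡⟨ cong V p[a+1]≡ ⟩
    V (suc (p * a + suc k))                 ≡⟨ V-suc (p * a + suc k) ⟩
    v (suc (p * a + suc k)) + V (p * a + suc k)
      ≡⟨ cong₂ _+_ (trans (cong v (sym p[a+1]≡)) (v-p* (suc a) (s≤s z≤n)))
                   (trans (V-same-block a (suc k) ≤-refl) (V-p* a)) ⟩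
    suc (v (suc a)) + (a + V a)             ≡⟨ rearrange (v (suc a)) a (V a) ⟩
    suc a + (v (suc a) + V a)               ≡⟨ cong (λ t → suc a + t) (sym (V-suc a)) ⟩
    suc a + V (suc a)                       ∎
    where
    p[a+1]≡ : p * suc a ≡ suc (p * a + suc k)
    p[a+1]≡ = trans (*-suc p a) (cong suc (+-comm (suc k) (p * a)))
    rearrange : ∀ x y z → suc x + (y + z) ≡ suc y + (x + z)
    rearrange = solve-∀

  legendre-step : ∀ a r → r < p → V (p * a + r) ≡ a + V a
  legendre-step a r r<p = trans (V-same-block a r r<p) (V-p* a)

  digits : ∀ j → j ≡ p * (j / p) + j % p
  digits j = trans (m≡m%n+[m/n]*n j p) (trans (+-comm (j % p) _) (cong (_+ j % p) (*-comm (j / p) p)))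

  -- Legendre's formula with the digit-sum bound: for j < p^(h+1) the digit sum
  -- s of j satisfies (p - 1)·v_p(j!) + s = j, and j ≤ s·p^h since j has at most
  -- h + 1 digits.
  digit-sum : ∀ h j → j < p ^ suc h → Σ ℕ λ s → (suc k * V j + s ≡ j) × (j ≤ s * p ^ h)
  digit-sum zero j j<p = j , legendre , m≤m*n j 1
    where
    V-j≡0 : V j ≡ 0
    V-j≡0 = trans (cong (λ t → V (t + j)) (sym (*-zeroʳ p)))
                  (trans (legendre-step 0 j (subst (j <_) (*-identityʳ p) j<p)) V-zero)
    legendre : suc k * V j + j ≡ j
    legendre = cong (_+ j) (trans (cong (suc k *_) V-j≡0) (*-zeroʳ (suc k)))
  digit-sum (suc h) j j<p^h+2 with digit-sum h (j / p) j/p<p^h+1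
    where
    j/p<p^h+1 : j / p < p ^ suc h
    j/p<p^h+1 = *-cancelˡ-< p (j / p) (p ^ suc h)
      (≤-<-trans (≤-trans (m≤m+n (p * (j / p)) (j % p)) (≤-reflexive (sym (digits j)))) j<p^h+2)
  ... | s , legendre , j/p≤ = s + j % p , legendre′ , bound
    where
    a r : ℕ
    a = j / p
    r = j % p
    legendre′ : suc k * V j + (s + r) ≡ j
    legendre′ = begin-equality
      suc k * V j + (s + r)              ≡⟨ cong (λ t → suc k * t + (s + r)) (trans (cong V (digits j)) (legendre-step a r (m%n<n j p))) ⟩
      suc k * (a + V a) + (s + r)        ≡⟨ rearrange (suc k) a (V a) s r ⟩
      (suc k * V a + s) + (suc k * a + r) ≡⟨ cong (_+ (suc k * a + r)) legendre ⟩
      a + (suc k * a + r)                ≡⟨ sym (+-assoc a (suc k * a) r) ⟩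
      p * a + r                          ≡⟨ sym (digits j) ⟩
      j                                  ∎
      where
      rearrange : ∀ b a w s r → b * (a + w) + (s + r) ≡ (b * w + s) + (b * a + r)
      rearrange = solve-∀
    bound : j ≤ (s + r) * p ^ suc h
    bound = begin
      j                                  ≡⟨ digits j ⟩
      p * a + r                          ≤⟨ +-mono-≤ (*-monoʳ-≤ p j/p≤) (m≤m*n r (p ^ suc h) {{m^n≢0 p (suc h)}}) ⟩
      p * (s * p ^ h) + r * p ^ suc h    ≡⟨ cong (_+ r * p ^ suc h) (x*[y*z]≡y*[x*z] p s (p ^ h)) ⟩
      s * p ^ suc h + r * p ^ suc h      ≡⟨ sym (*-distribʳ-+ (p ^ suc h) s r) ⟩
      (s + r) * p ^ suc h                ∎
      where
      x*[y*z]≡y*[x*z] : ∀ x y z → x * (y * z) ≡ y * (x * z)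
      x*[y*z]≡y*[x*z] = solve-∀

  -- Legendre's formula for q = p^h, whose digit sum is 1: (p - 1)·v_p(q!) + 1 = q.
  legendre-power : ∀ h → suc k * V (p ^ h) + 1 ≡ p ^ h
  legendre-power zero = trans (cong (λ t → suc k * t + 1) V-zero) (cong (_+ 1) (*-zeroʳ (suc k)))
  legendre-power (suc h) = begin-equality
    suc k * V (p * p ^ h) + 1               ≡⟨ cong (λ t → suc k * t + 1) (V-p* (p ^ h)) ⟩
    suc k * (p ^ h + V (p ^ h)) + 1         ≡⟨ rearrange (suc k) (p ^ h) (V (p ^ h)) ⟩
    (suc k * V (p ^ h) + 1) + suc k * p ^ h ≡⟨ cong (_+ suc k * p ^ h) (legendre-power h) ⟩
    p * p ^ h                               ∎
    where
    rearrange : ∀ b x w → b * (x + w) + 1 ≡ (b * w + 1) + b * x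
    rearrange = solve-∀

  pred-p^ : ∀ h → suc (p ^ h ∸ 1) ≡ p ^ h
  pred-p^ h = m+[n∸m]≡n (m^n>0 p h)

  V-p^ : ∀ h → V (p ^ h) ≡ h + V (p ^ h ∸ 1)
  V-p^ h = begin-equality
    V (p ^ h)                           ≡⟨ cong V (sym (pred-p^ h)) ⟩
    V (suc (p ^ h ∸ 1))                 ≡⟨ V-suc (p ^ h ∸ 1) ⟩
    v (suc (p ^ h ∸ 1)) + V (p ^ h ∸ 1) ≡⟨ cong (λ t → v t + V (p ^ h ∸ 1)) (trans (pred-p^ h) (sym (*-identityʳ (p ^ h)))) ⟩
    v (p ^ h * 1) + V (p ^ h ∸ 1)       ≡⟨ cong (_+ V (p ^ h ∸ 1)) (trans (v-p^* h 1 (s≤s z≤n)) (cong (h +_) V-zero)) ⟩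
    (h + 0) + V (p ^ h ∸ 1)             ≡⟨ cong (_+ V (p ^ h ∸ 1)) (+-identityʳ h) ⟩
    h + V (p ^ h ∸ 1)                   ∎

  V-block : ∀ h x j → p ^ h ∣ x → j < p ^ h → V (x + j) ≡ V x + V j
  V-block h x zero _ _ = trans (cong V (+-identityʳ x)) (sym (trans (cong (λ t → V x + t) V-zero) (+-identityʳ (V x))))
  V-block h x (suc j) p^h∣x j<p^h = begin-equality
    V (x + suc j)                  ≡⟨ cong V (+-suc x j) ⟩
    V (suc (x + j))                ≡⟨ V-suc (x + j) ⟩
    v (suc (x + j)) + V (x + j)    ≡⟨ cong₂ _+_ (trans (cong v (sym (+-suc x j))) (v-shift h x (suc j) p^h∣x (s≤s z≤n) j<p^h))
                                                (V-block h x j p^h∣x (<⇒≤ j<p^h)) ⟩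
    v (suc j) + (V x + V j)        ≡⟨ rearrange (v (suc j)) (V x) (V j) ⟩
    V x + (v (suc j) + V j)        ≡⟨ cong (λ t → V x + t) (sym (V-suc j)) ⟩
    V x + V (suc j)                ∎
    where
    rearrange : ∀ a b c → a + (b + c) ≡ b + (a + c)
    rearrange = solve-∀

  -- Passing from one block to the next adds v_p(q!) and the valuation of the
  -- new multiple (c + 1)·q, which is h + v_p(c + 1).
  V-next-block : ∀ h c → V (c * p ^ h + p ^ h) ≡ V (c * p ^ h) + V (p ^ h) + v (suc c)
  V-next-block h c = begin-equality
    V (c * q + q)                     ≡⟨ cong V (trans (cong (c * q +_) (sym (pred-p^ h))) (+-suc (c * q) q₁)) ⟩
    V (suc (c * q + q₁))              ≡⟨ V-suc (c * q + q₁) ⟩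
    v (suc (c * q + q₁)) + V (c * q + q₁)
      ≡⟨ cong₂ _+_ (trans (cong v last≡q*[c+1]) (v-p^* h (suc c) (s≤s z≤n)))
                   (V-block h (c * q) q₁ (n∣m*n c) (subst (q₁ <_) (pred-p^ h) ≤-refl)) ⟩
    (h + v (suc c)) + (V (c * q) + V q₁) ≡⟨ rearrange h (v (suc c)) (V (c * q)) (V q₁) ⟩
    V (c * q) + (h + V q₁) + v (suc c)   ≡⟨ cong (λ t → V (c * q) + t + v (suc c)) (sym (V-p^ h)) ⟩
    V (c * q) + V q + v (suc c)          ∎
    where
    q q₁ : ℕ
    q = p ^ h
    q₁ = p ^ h ∸ 1
    last≡q*[c+1] : suc (c * q + q₁) ≡ q * suc c
    last≡q*[c+1] = begin-equality
      suc (c * q + q₁)   ≡⟨ sym (+-suc (c * q) q₁) ⟩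
      c * q + suc q₁     ≡⟨ cong (c * q +_) (pred-p^ h) ⟩
      c * q + q          ≡⟨ +-comm (c * q) q ⟩
      q + c * q          ≡⟨ cong (q +_) (*-comm c q) ⟩
      q + q * c          ≡⟨ sym (*-suc q c) ⟩
      q * suc c          ∎
    rearrange : ∀ h w a b → (h + w) + (a + b) ≡ a + (h + b) + w
    rearrange = solve-∀

  -- No carries occur when adding a + b = q - 1: v_p((a + b)!) = v_p(a!) + v_p(b!).
  V-complement : ∀ h a b → suc (a + b) ≡ p ^ h → V (a + b) ≡ V a + V b
  V-complement h zero b _ = cong (_+ V b) (sym V-zero)
  V-complement h (suc a) b a+b+1≡q = begin-equality
    V (suc a + b)                 ≡⟨ cong V (sym (+-suc a b)) ⟩
    V (a + suc b)                 ≡⟨ V-complement h a (suc b) (trans (cong suc (+-suc a b)) a+b+1≡q) ⟩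
    V a + V (suc b)               ≡⟨ cong (λ t → V a + t) (V-suc b) ⟩
    V a + (v (suc b) + V b)       ≡⟨ cong (λ t → V a + (t + V b)) (v-mod-p^ h (suc b) (suc a) (s≤s z≤n) (s≤s z≤n) a+1<q q∣) ⟩
    V a + (v (suc a) + V b)       ≡⟨ rearrange (V a) (v (suc a)) (V b) ⟩
    v (suc a) + V a + V b         ≡⟨ cong (_+ V b) (sym (V-suc a)) ⟩
    V (suc a) + V b               ∎
    where
    a+1<q : suc a < p ^ h
    a+1<q = subst (suc a <_) a+b+1≡q (s≤s (m≤m+n (suc a) b))
    q∣ : p ^ h ∣ suc b + suc a
    q∣ = divides 1 (trans (cong suc (trans (+-suc b a) (cong suc (+-comm b a))))
                          (trans a+b+1≡q (sym (*-identityˡ (p ^ h)))))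
    rearrange : ∀ a b c → a + (b + c) ≡ b + a + c
    rearrange = solve-∀


module Scaling (b a : ℕ) (c : ℚ) (c-def : c ≡ inv (suc b) Q.- inv (suc a)) where

  open import Data.Integer using (+_)
  open ≡-Reasoning

  B A : ℕ
  B = suc b
  A = suc a

  ordAt : ℕ → ℕ → ℚ
  ordAt W n = (+ W Q./ 1) Q.- (+ n Q./ 1) Q.* c

  -- A·B·w + B·n - A·n, i.e. A·B·(w - n·c).
  weightℤ : ℤ → ℤ → ℤ
  weightℤ w n = w Z.* (+ A Z.* + B) Z.+ n Z.* + B Z.- n Z.* + A

  weight : ℕ → ℕ → ℤ
  weight W n = weightℤ (+ W) (+ n)

  weight-sum : ∀ W₁ W₂ d x y →
    weight (W₁ + W₂ + d) (x + y) ≡ weight W₁ x Z.+ weight W₂ y Z.+ + (d * (A * B))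
  weight-sum W₁ W₂ d x y = begin
    weightℤ (+ (W₁ + W₂ + d)) (+ (x + y))
      ≡⟨ cong₂ weightℤ (trans (ZP.pos-+ (W₁ + W₂) d) (cong (Z._+ + d) (ZP.pos-+ W₁ W₂))) (ZP.pos-+ x y) ⟩
    weightℤ (+ W₁ Z.+ + W₂ Z.+ + d) (+ x Z.+ + y)
      ≡⟨ linear (+ W₁) (+ W₂) (+ d) (+ x) (+ y) (+ A) (+ B) ⟩
    weight W₁ x Z.+ weight W₂ y Z.+ + d Z.* (+ A Z.* + B)
      ≡⟨ cong (λ t → weight W₁ x Z.+ weight W₂ y Z.+ t) (sym (trans (ZP.pos-* d (A * B)) (cong (+ d Z.*_) (ZP.pos-* A B)))) ⟩
    weight W₁ x Z.+ weight W₂ y Z.+ + (d * (A * B)) ∎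
    where
    linear : ∀ w₁ w₂ d x y a b →
      (w₁ Z.+ w₂ Z.+ d) Z.* (a Z.* b) Z.+ (x Z.+ y) Z.* b Z.- (x Z.+ y) Z.* a
      ≡ (w₁ Z.* (a Z.* b) Z.+ x Z.* b Z.- x Z.* a) Z.+ (w₂ Z.* (a Z.* b) Z.+ y Z.* b Z.- y Z.* a) Z.+ d Z.* (a Z.* b)
    linear = ZR.solve-∀

  -- If n·A = W·A·B + t (Legendre's formula times A, t = A·digit sum), the
  -- weight is B·n - t.
  weight-via-legendre : ∀ W n t → n * A ≡ W * (A * B) + t → weight W n ≡ (n * B) ⊖ t
  weight-via-legendre W n t n*A≡ = begin
    + W Z.* (+ A Z.* + B) Z.+ + n Z.* + B Z.- + n Z.* + A
      ≡⟨ cong (λ u → + W Z.* (+ A Z.* + B) Z.+ + n Z.* + B Z.- u) n*A≡ℤ ⟩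
    + W Z.* (+ A Z.* + B) Z.+ + n Z.* + B Z.- (+ W Z.* (+ A Z.* + B) Z.+ + t)
      ≡⟨ cancel (+ W Z.* (+ A Z.* + B)) (+ n Z.* + B) (+ t) ⟩
    + n Z.* + B Z.- + t    ≡⟨ cong (Z._- + t) (sym (ZP.pos-* n B)) ⟩
    + (n * B) Z.- + t      ≡⟨ ZP.m-n≡m⊖n (n * B) t ⟩
    (n * B) ⊖ t            ∎
    where
    cancel : ∀ x y t → x Z.+ y Z.- (x Z.+ t) ≡ y Z.- t
    cancel = ZR.solve-∀
    n*A≡ℤ : + n Z.* + A ≡ + W Z.* (+ A Z.* + B) Z.+ + t
    n*A≡ℤ = begin
      + n Z.* + A                     ≡⟨ sym (ZP.pos-* n A) ⟩
      + (n * A)                       ≡⟨ cong +_ n*A≡ ⟩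
      + (W * (A * B) + t)             ≡⟨ ZP.pos-+ (W * (A * B)) t ⟩
      + (W * (A * B)) Z.+ + t         ≡⟨ cong (Z._+ + t) (trans (ZP.pos-* W (A * B)) (cong (+ W Z.*_) (ZP.pos-* A B))) ⟩
      + W Z.* (+ A Z.* + B) Z.+ + t   ∎

  ι : ℤ → ℚᵘ
  ι z = mkℚᵘ z 0

  ι-+ : ∀ x y → ι (x Z.+ y) U.≃ ι x U.+ ι y
  ι-+ x y = *≡* (rescale x y)
    where
    rescale : ∀ x y → (x Z.+ y) Z.* + 1 ≡ (x Z.* + 1 Z.+ y Z.* + 1) Z.* + 1
    rescale = ZR.solve-∀

  ι-- : ∀ x y → ι (x Z.- y) U.≃ ι x U.- ι y
  ι-- x y = UP.≃-trans (ι-+ x (Z.- y)) (UP.+-congʳ (ι x) ι-neg)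
    where
    ι-neg : ι (Z.- y) U.≃ U.- ι y
    ι-neg = *≡* refl

  ι-weight : ∀ w n → ι (weightℤ w n) U.≃ ι w U.* (ι (+ A) U.* ι (+ B)) U.+ ι n U.* ι (+ B) U.- ι n U.* ι (+ A)
  ι-weight w n = UP.≃-trans (ι-- (w Z.* (+ A Z.* + B) Z.+ n Z.* + B) (n Z.* + A))
                            (UP.+-congˡ (U.- ι (n Z.* + A)) (ι-+ (w Z.* (+ A Z.* + B)) (n Z.* + B)))

  toℚᵘ-- : ∀ x y → toℚᵘ (x Q.- y) U.≃ toℚᵘ x U.- toℚᵘ y
  toℚᵘ-- x y = UP.≃-trans (QP.toℚᵘ-homo-+ x (Q.- y)) (UP.+-congʳ (toℚᵘ x) (QP.toℚᵘ-homo‿- y))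

  toℚᵘ-c : toℚᵘ c U.≃ mkℚᵘ (+ 1) b U.- mkℚᵘ (+ 1) a
  toℚᵘ-c = subst (λ c′ → toℚᵘ c′ U.≃ _) (sym c-def)
    (UP.≃-trans (toℚᵘ-- (inv B) (inv A))
                (UP.+-cong (QP.toℚᵘ-fromℚᵘ (mkℚᵘ (+ 1) b)) (UP.-‿cong (QP.toℚᵘ-fromℚᵘ (mkℚᵘ (+ 1) a)))))

  toℚᵘ-ordAt : ∀ W n → toℚᵘ (ordAt W n) U.≃ ι (+ W) U.- ι (+ n) U.* (mkℚᵘ (+ 1) b U.- mkℚᵘ (+ 1) a)
  toℚᵘ-ordAt W n = UP.≃-trans (toℚᵘ-- (+ W Q./ 1) ((+ n Q./ 1) Q.* c))
    (UP.+-cong (QP.toℚᵘ-fromℚᵘ (ι (+ W)))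
               (UP.-‿cong (UP.≃-trans (QP.toℚᵘ-homo-* (+ n Q./ 1) c)
                                      (UP.*-cong (QP.toℚᵘ-fromℚᵘ (ι (+ n))) toℚᵘ-c))))

  ringᵘ : AlmostCommutativeRing 0ℓ 0ℓ
  ringᵘ = fromCommutativeRing UP.+-*-commutativeRing (λ _ → nothing)

  clear-denominators : ∀ w n x y X Y → x U.* X U.≃ U.1ℚᵘ → y U.* Y U.≃ U.1ℚᵘ →
    (w U.- n U.* (x U.- y)) U.* (Y U.* X) U.≃ w U.* (Y U.* X) U.+ n U.* X U.- n U.* Y
  clear-denominators w n x y X Y xX≡1 yY≡1 = UP.≃-trans (expand w n x y X Y)
    (UP.≃-trans (UP.+-cong (UP.+-congʳ (w U.* (Y U.* X)) (UP.-‿cong (UP.*-congˡ {n U.* Y} xX≡1)))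
                           (UP.*-congˡ {n U.* X} yY≡1))
                (simplify w n X Y))
    where
    expand : ∀ w n x y X Y → (w U.- n U.* (x U.- y)) U.* (Y U.* X)
      U.≃ w U.* (Y U.* X) U.- n U.* Y U.* (x U.* X) U.+ n U.* X U.* (y U.* Y)
    expand = RS.solve-∀ ringᵘ
    simplify : ∀ w n X Y → w U.* (Y U.* X) U.- n U.* Y U.* U.1ℚᵘ U.+ n U.* X U.* U.1ℚᵘ
      U.≃ w U.* (Y U.* X) U.+ n U.* X U.- n U.* Y
    simplify = RS.solve-∀ ringᵘ

  AB : ℚᵘ
  AB = ι (+ A) U.* ι (+ B)

  scaled : ∀ W n → toℚᵘ (ordAt W n) U.* AB U.≃ ι (weight W n)
  scaled W n = UP.≃-trans (UP.*-congʳ (toℚᵘ-ordAt W n))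
    (UP.≃-trans (clear-denominators (ι (+ W)) (ι (+ n)) (mkℚᵘ (+ 1) b) (mkℚᵘ (+ 1) a) (ι (+ B)) (ι (+ A)) (*≡* (unit b)) (*≡* (unit a)))
                (UP.≃-sym (ι-weight (+ W) (+ n))))
    where
    unit : ∀ d → (+ 1 Z.* + suc d) Z.* + 1 ≡ + 1 Z.* + suc (d * 1)
    unit d = trans (ZP.*-identityʳ _) (trans (ZP.*-identityˡ (+ suc d))
                   (sym (trans (ZP.*-identityˡ _) (cong (λ t → + suc t) (*-identityʳ d)))))

  ι-< : ∀ {z w} → z Z.< w → ι z U.< ι w
  ι-< {z} {w} z<w = *<* (subst₂ Z._<_ (sym (ZP.*-identityʳ z)) (sym (ZP.*-identityʳ w)) z<w)

  ι-≤ : ∀ {z w} → z Z.≤ w → ι z U.≤ ι w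
  ι-≤ {z} {w} z≤w = *≤* (subst₂ Z._≤_ (sym (ZP.*-identityʳ z)) (sym (ZP.*-identityʳ w)) z≤w)

  compare-< : ∀ {x y : ℚ} {z w : ℤ} → toℚᵘ x U.* AB U.≃ ι z → toℚᵘ y U.* AB U.≃ ι w → z Z.< w → x Q.< y
  compare-< xAB≃z yAB≃w z<w = QP.toℚᵘ-cancel-< (UP.*-cancelʳ-<-nonNeg AB
    (UP.<-respˡ-≃ (UP.≃-sym xAB≃z) (UP.<-respʳ-≃ (UP.≃-sym yAB≃w) (ι-< z<w))))

  compare-≤ : ∀ {x y : ℚ} {z w : ℤ} → toℚᵘ x U.* AB U.≃ ι z → toℚᵘ y U.* AB U.≃ ι w → z Z.≤ w → x Q.≤ y
  compare-≤ xAB≃z yAB≃w z≤w = QP.toℚᵘ-cancel-≤ (UP.*-cancelʳ-≤-pos AB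
    (UP.≤-respˡ-≃ (UP.≃-sym xAB≃z) (UP.≤-respʳ-≃ (UP.≃-sym yAB≃w) (ι-≤ z≤w))))

  ordAt-< : ∀ W n W′ m → weight W n Z.< weight W′ m → ordAt W n Q.< ordAt W′ m
  ordAt-< W n W′ m = compare-< (scaled W n) (scaled W′ m)

  ordAt-≤ : ∀ W n W′ m → weight W n Z.≤ weight W′ m → ordAt W n Q.≤ ordAt W′ m
  ordAt-≤ W n W′ m = compare-≤ (scaled W n) (scaled W′ m)

  ordAt-negative : ∀ W n → weight W n Z.< + 0 → ordAt W n Q.< 0ℚ
  ordAt-negative W n = compare-< (scaled W n) (*≡* refl)


-- The four assertions of Proposition 3.4 about a function ω, with q = p^h; in the
-- theorem ω = ord p e h, and ω n < ω m means |n!/ϖ_p^n| > |m!/ϖ_p^m|.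
Assertions : (ℕ → ℚ) → ℕ → ℕ → Set
Assertions ω p h =
    ((n : ℕ) → 0 < n → n < p ^ h → ω n <ℚ 0ℚ)
  × ((n : ℕ) → floorMul p h n ≤ n × ((m : ℕ) → m ≤ n → ω m ≤ℚ ω (floorMul p h n)))
  × ((n : ℕ) → p ^ h ∣ n + 1 → (i : ℕ) → 1 ≤ i → i ≤ p ^ h ∸ 1
       → (ω n <ℚ ω (n + p ^ h)) × (ω (n + p ^ h) <ℚ ω (n + i)))
  × ((n : ℕ) → n ≤ floorMul p h n + p ^ h ∸ 1
       × ((m : ℕ) → n ≤ m → ω (floorMul p h n + p ^ h ∸ 1) ≤ℚ ω m))


module Weights (k : ℕ) (p-prime : Prime (suc (suc k))) (h₀ a : ℕ) (c : ℚ)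
  (c-def : c ≡ inv (suc k) Q.- inv (suc a))
  (p^[h-1]B<A : suc (suc k) ^ h₀ * suc k < suc a)
  (A<Bq : suc a < suc k * suc (suc k) ^ suc h₀) where

  open Valuation k p-prime
  open Scaling k a c c-def
  open import Data.Integer using (+_)
  open ≤-Reasoning

  h q q₁ : ℕ
  h = suc h₀
  q = p ^ h
  q₁ = q ∸ 1

  q₁<q : q₁ < q
  q₁<q = subst (q₁ <_) (pred-p^ h) ≤-refl

  instance
    q-nonzero : NonZero q
    q-nonzero = m^n≢0 p h

  ω : ℕ → ℚ
  ω n = ordAt (V n) n

  G : ℕ → ℤ
  G n = weight (V n) n

  G-additive : ∀ x y → V (x + y) ≡ V x + V y → G (x + y) ≡ G x Z.+ G y
  G-additive x y V-additive = trans (cong (λ W → weight W (x + y)) (trans V-additive (sym (+-identityʳ _))))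
    (trans (weight-sum (V x) (V y) 0 x y) (ZP.+-identityʳ _))

  G-block : ∀ c j → j < q → G (c * q + j) ≡ G (c * q) Z.+ G j
  G-block c j j<q = G-additive (c * q) j (V-block h (c * q) j (n∣m*n c) j<q)

  G-decompose : ∀ m → G m ≡ G ((m / q) * q) Z.+ G (m % q)
  G-decompose m = trans (cong G (trans (m≡m%n+[m/n]*n m q) (+-comm (m % q) _)))
                        (G-block (m / q) (m % q) (m%n<n m q))

  G-complement : ∀ j → j ≤ q₁ → G q₁ ≡ G j Z.+ G (q₁ ∸ j)
  G-complement j j≤q₁ = trans (cong G (sym j+[q₁∸j]≡q₁))
    (G-additive j (q₁ ∸ j) (V-complement h j (q₁ ∸ j) (trans (cong suc j+[q₁∸j]≡q₁) (pred-p^ h))))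
    where
    j+[q₁∸j]≡q₁ : j + (q₁ ∸ j) ≡ q₁
    j+[q₁∸j]≡q₁ = m+[n∸m]≡n j≤q₁

  -- G(j) = B·j - A·s(j) < 0 on the first block: j ≤ s(j)·p^(h-1) and p^(h-1)·B < A.
  G-negative : ∀ j → 0 < j → j < q → G j Z.< + 0
  G-negative j j>0 j<q with digit-sum h₀ j j<q
  ... | s , legendre , j≤s·X =
    subst (Z._< + 0) (sym (weight-via-legendre (V j) j (s * A) j*A≡)) (⊖-negative (jB<sA s j≤s·X))
    where
    j*A≡ : j * A ≡ V j * (A * B) + s * A
    j*A≡ = trans (cong (_* A) (sym legendre)) (rearrange B (V j) s A)
      where
      rearrange : ∀ b w s a → (b * w + s) * a ≡ w * (a * b) + s * a
      rearrange = solve-∀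
    jB<sA : ∀ s → j ≤ s * p ^ h₀ → j * B < s * A
    jB<sA zero j≤0 = contradiction j≤0 (<⇒≱ j>0)
    jB<sA (suc s) j≤s·X = begin-strict
      j * B                    ≤⟨ *-monoˡ-≤ B j≤s·X ⟩
      suc s * p ^ h₀ * B       ≡⟨ *-assoc (suc s) (p ^ h₀) B ⟩
      suc s * (p ^ h₀ * B)     <⟨ *-monoʳ-< (suc s) p^[h-1]B<A ⟩
      suc s * A                ∎

  G-nonpositive : ∀ j → j < q → G j Z.≤ + 0
  G-nonpositive zero _ = ZP.≤-reflexive (cong (λ W → weight W 0) V-zero)
  G-nonpositive (suc j) j<q = ZP.<⇒≤ (G-negative (suc j) (s≤s z≤n) j<q)

  -- G(q) = B·q - A > 0, the digit sum of q being 1.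
  G-q-positive : + 0 Z.< G q
  G-q-positive = subst (+ 0 Z.<_) (sym (weight-via-legendre (V q) q (1 * A) q*A≡)) (⊖-positive A<qB)
    where
    q*A≡ : q * A ≡ V q * (A * B) + 1 * A
    q*A≡ = trans (cong (_* A) (sym (legendre-power h))) (rearrange B (V q) A)
      where
      rearrange : ∀ b w a → (b * w + 1) * a ≡ w * (a * b) + 1 * a
      rearrange = solve-∀
    A<qB : 1 * A < q * B
    A<qB = subst₂ _<_ (sym (*-identityˡ A)) (*-comm B q) A<Bq

  G-increasing : ∀ c → G (c * q) Z.< G (suc c * q)
  G-increasing c = subst (G (c * q) Z.<_) (sym G[cq+q]) (ZP.<-≤-trans
    (subst (Z._< G (c * q) Z.+ G q) (ZP.+-identityʳ (G (c * q))) (ZP.+-monoʳ-< (G (c * q)) G-q-positive))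
    (ZP.i≤i+j (G (c * q) Z.+ G q) (+ (v (suc c) * (A * B)))))
    where
    G[cq+q] : G (suc c * q) ≡ G (c * q) Z.+ G q Z.+ + (v (suc c) * (A * B))
    G[cq+q] = trans (cong G (+-comm q (c * q)))
      (trans (cong (λ W → weight W (c * q + q)) (V-next-block h c)) (weight-sum (V (c * q)) (V q) (v (suc c)) (c * q) q))

  G-monotone : ∀ c d → c ≤ d → G (c * q) Z.≤ G (d * q)
  G-monotone c d c≤d = along (≤⇒≤′ c≤d)
    where
    along : ∀ {d′} → c ≤′ d′ → G (c * q) Z.≤ G (d′ * q)
    along ≤′-refl = ZP.≤-refl
    along {suc d′} (≤′-step c≤′d) = ZP.≤-trans (along c≤′d) (ZP.<⇒≤ (G-increasing d′))

  G-last-minimal : ∀ j → j ≤ q₁ → G q₁ Z.≤ G j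
  G-last-minimal j j≤q₁ = subst (Z._≤ G j) (sym (G-complement j j≤q₁))
    (plus-nonpositive (G j) (G-nonpositive (q₁ ∸ j) (≤-<-trans (m∸n≤m q₁ j) q₁<q)))

  G-last-strict : ∀ j → j < q₁ → G q₁ Z.< G j
  G-last-strict j j<q₁ = subst (Z._< G j) (sym (G-complement j (<⇒≤ j<q₁)))
    (plus-negative (G j) (G-negative (q₁ ∸ j) (m<n⇒0<n∸m j<q₁) (≤-<-trans (m∸n≤m q₁ j) q₁<q)))

  ω-< : ∀ n m → G n Z.< G m → ω n <ℚ ω m
  ω-< n m = ordAt-< (V n) n (V m) m

  ω-≤ : ∀ n m → G n Z.≤ G m → ω n ≤ℚ ω m
  ω-≤ n m = ordAt-≤ (V n) n (V m) m

  remainder≤q₁ : ∀ m → m % q ≤ q₁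
  remainder≤q₁ m = ≤-pred (subst (m % q <_) (sym (pred-p^ h)) (m%n<n m q))

  last-of-block : ∀ n → q ∣ n + 1 → Σ ℕ λ c → n ≡ c * q + q₁
  last-of-block n (divides zero n+1≡0) = contradiction (trans (+-comm 1 n) n+1≡0) 1+n≢0
  last-of-block n (divides (suc c) n+1≡) = c , +-cancelʳ-≡ 1 n (c * q + q₁) (begin-equality
    n + 1              ≡⟨ n+1≡ ⟩
    q + c * q          ≡⟨ cong (λ t → t + c * q) (sym (pred-p^ h)) ⟩
    suc q₁ + c * q     ≡⟨ +-comm (suc q₁) (c * q) ⟩
    c * q + suc q₁     ≡⟨ +-suc (c * q) q₁ ⟩
    suc (c * q + q₁)   ≡⟨ +-comm 1 (c * q + q₁) ⟩
    c * q + q₁ + 1     ∎)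

  part-i : ∀ n → 0 < n → n < q → ω n <ℚ 0ℚ
  part-i n n>0 n<q = ordAt-negative (V n) n (G-negative n n>0 n<q)

  part-ii : ∀ n → (n / q) * q ≤ n × (∀ m → m ≤ n → ω m ≤ℚ ω ((n / q) * q))
  part-ii n = m/n*n≤m n q , λ m m≤n → ω-≤ m ((n / q) * q)
    (subst (Z._≤ G ((n / q) * q)) (sym (G-decompose m))
      (ZP.≤-trans (plus-nonpositive (G ((m / q) * q)) (G-nonpositive (m % q) (m%n<n m q)))
                  (G-monotone (m / q) (n / q) (/-monoˡ-≤ q m≤n))))

  part-iii : ∀ n → q ∣ n + 1 → ∀ i → 1 ≤ i → i ≤ q₁
    → (ω n <ℚ ω (n + q)) × (ω (n + q) <ℚ ω (n + i))
  part-iii n q∣n+1 (suc i) _ i<q₁ with last-of-block n q∣n+1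
  ... | c , n≡ = ω-< n (n + q) (subst₂ Z._<_ (sym G-n) (sym G-n+q) (ZP.+-monoˡ-< (G q₁) (G-increasing c)))
               , ω-< (n + q) (n + suc i) (subst₂ Z._<_ (sym G-n+q) (sym G-n+i)
                   (ZP.+-monoʳ-< (G (suc c * q)) (G-last-strict i i<q₁)))
    where
    G-n : G n ≡ G (c * q) Z.+ G q₁
    G-n = trans (cong G n≡) (G-block c q₁ q₁<q)
    G-n+q : G (n + q) ≡ G (suc c * q) Z.+ G q₁
    G-n+q = trans (cong G (trans (cong (_+ q) n≡) (rearrange (c * q) q₁ q))) (G-block (suc c) q₁ q₁<q)
      where
      rearrange : ∀ x y z → x + y + z ≡ z + x + y
      rearrange = solve-∀
    G-n+i : G (n + suc i) ≡ G (suc c * q) Z.+ G i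
    G-n+i = trans (cong G n+i≡) (G-block (suc c) i (<-trans i<q₁ q₁<q))
      where
      rearrange : ∀ x y i → x + y + suc i ≡ suc y + x + i
      rearrange = solve-∀
      n+i≡ : n + suc i ≡ suc c * q + i
      n+i≡ = trans (cong (_+ suc i) n≡)
               (trans (rearrange (c * q) q₁ i) (cong (λ t → t + c * q + i) (pred-p^ h)))

  part-iv : ∀ n → n ≤ (n / q) * q + q ∸ 1 × (∀ m → n ≤ m → ω ((n / q) * q + q ∸ 1) ≤ℚ ω m)
  part-iv n = subst (n ≤_) (sym top≡) n≤top , λ m n≤m → ω-≤ ((n / q) * q + q ∸ 1) m
    (subst₂ Z._≤_ (sym (trans (cong G top≡) (G-block (n / q) q₁ q₁<q))) (sym (G-decompose m))
      (ZP.+-mono-≤ (G-monotone (n / q) (m / q) (/-monoˡ-≤ q n≤m)) (G-last-minimal (m % q) (remainder≤q₁ m))))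
    where
    top≡ : (n / q) * q + q ∸ 1 ≡ (n / q) * q + q₁
    top≡ = +-∸-assoc ((n / q) * q) (m^n>0 p h)
    n≤top : n ≤ (n / q) * q + q₁
    n≤top = subst (_≤ (n / q) * q + q₁) (sym (trans (m≡m%n+[m/n]*n n q) (+-comm (n % q) _)))
              (+-monoʳ-≤ ((n / q) * q) (remainder≤q₁ n))

  assertions : Assertions ω p h
  assertions = part-i , part-ii , part-iii , part-iv


denominator-bounds : ∀ k e X q₁ → 1 ≤ e → e ≤ suc k → 1 ≤ X → suc k * X + X ≡ suc q₁
  → (1 < e ⊎ 1 < X) → (X * suc k < e * q₁) × (e * q₁ < suc k * suc q₁)
denominator-bounds k e X q₁ 1≤e e≤p-1 1≤X q≡ large = lower large , upper
  where
  open ≤-Reasoning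
  BX+X≤ : ∀ {Y} → Y ≤ X → Y + suc k * X ≤ suc q₁
  BX+X≤ {Y} Y≤X = subst (Y + suc k * X ≤_) q≡ (subst (_≤ suc k * X + X) (+-comm (suc k * X) Y) (+-monoʳ-≤ (suc k * X) Y≤X))
  BX≤q₁ : suc k * X ≤ q₁
  BX≤q₁ = ≤-pred (BX+X≤ 1≤X)
  lower : (1 < e ⊎ 1 < X) → X * suc k < e * q₁
  lower (inj₁ 2≤e) = begin-strict
    X * suc k     ≡⟨ *-comm X (suc k) ⟩
    suc k * X     ≤⟨ BX≤q₁ ⟩
    q₁            <⟨ m<m+n q₁ (≤-trans (*-positive {suc k} (s≤s z≤n) 1≤X) BX≤q₁) ⟩
    q₁ + q₁       ≡⟨ cong (λ t → q₁ + t) (sym (+-identityʳ q₁)) ⟩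
    2 * q₁        ≤⟨ *-monoˡ-≤ q₁ 2≤e ⟩
    e * q₁        ∎
  lower (inj₂ 2≤X) = begin-strict
    X * suc k     ≡⟨ *-comm X (suc k) ⟩
    suc k * X     <⟨ ≤-pred (BX+X≤ 2≤X) ⟩
    q₁            ≡⟨ sym (*-identityˡ q₁) ⟩
    1 * q₁        ≤⟨ *-monoˡ-≤ q₁ 1≤e ⟩
    e * q₁        ∎
  upper : e * q₁ < suc k * suc q₁
  upper = begin-strict
    e * q₁        ≤⟨ *-monoˡ-≤ q₁ e≤p-1 ⟩
    suc k * q₁    <⟨ *-monoʳ-< (suc k) ≤-refl ⟩
    suc k * suc q₁ ∎

assertions-for : ∀ p e h → 1 < p → Prime p → 1 ≤ e → 1 ≤ h → e ≤ p ∸ 1 → (1 < e ⊎ 1 < h)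
  → Assertions (ord p e h) p h
assertions-for (suc (suc k)) e (suc h₀) _ p-prime 1≤e _ e≤p-1 large =
  Weights.assertions k p-prime h₀ a (valPeriod p e (suc h₀)) c-def
    (subst (X * suc k <_) (sym A≡) lower) (subst₂ _<_ (sym A≡) (cong (suc k *_) (pred-p^ (suc h₀))) upper)
  where
  open Valuation k p-prime using (p; 1<p; pred-p^)
  X q₁ a : ℕ
  X = p ^ h₀
  q₁ = p ^ suc h₀ ∸ 1
  1<X : 1 < suc h₀ → 1 < X
  1<X (s≤s 1≤h₀) = <-≤-trans 1<p (subst (_≤ X) (*-identityʳ p) (^-monoʳ-≤ p 1≤h₀))
  bounds : (X * suc k < e * q₁) × (e * q₁ < suc k * suc q₁)
  bounds = denominator-bounds k e X q₁ 1≤e e≤p-1 (m^n>0 p h₀)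
             (trans (+-comm (suc k * X) X) (sym (pred-p^ (suc h₀)))) (map₂ 1<X large)
  lower : X * suc k < e * q₁
  lower = proj₁ bounds
  upper : e * q₁ < suc k * suc q₁
  upper = proj₂ bounds
  a = e * q₁ ∸ 1
  A≡ : suc a ≡ e * q₁
  A≡ = m+[n∸m]≡n (≤-trans (s≤s z≤n) lower)
  c-def : valPeriod p e (suc h₀) ≡ inv (suc k) Q.- inv (suc a)
  c-def = cong (λ A → inv (suc k) Q.- inv A) (sym A≡)
assertions-for (suc (suc k)) e zero _ _ _ () _ _

proposition3p4 : (p e h : ℕ) → Prime p → 1 ≤ e → 1 ≤ h
    → e ≤ p ∸ 1 → (1 < e ⊎ 1 < h)
    → ((n : ℕ) → 0 < n → n < p ^ h → ord p e h n <ℚ 0ℚ)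
    × ((n : ℕ) → floorMul p h n ≤ n
         × ((m : ℕ) → m ≤ n → ord p e h m ≤ℚ ord p e h (floorMul p h n)))
    × ((n : ℕ) → p ^ h ∣ n + 1 → (i : ℕ) → 1 ≤ i → i ≤ p ^ h ∸ 1
         → (ord p e h n <ℚ ord p e h (n + p ^ h))
           × (ord p e h (n + p ^ h) <ℚ ord p e h (n + i)))
    × ((n : ℕ) → n ≤ floorMul p h n + p ^ h ∸ 1
         × ((m : ℕ) → n ≤ m
              → ord p e h (floorMul p h n + p ^ h ∸ 1) ≤ℚ ord p e h m))
proposition3p4 p e h p-prime =
  assertions-for p e h (nonTrivial⇒n>1 p {{prime⇒nonTrivial p-prime}}) p-prime
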